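{- Let $n$ be a positive integer and $T_n$ the transitive tournament on $n$ vertices. Then the OR-power $[M(T_n)\setminus\{z\}]^n$ contains a transitive clique of size $n^n$ each of whose vertices (a sequence of length $n$) has at least one coordinate belonging to $V(T_n)\times\{1\}$.
   Context: $T_n$ is the digraph on vertices $1,\dots,n$ with $(i,j)$ an edge iff $i<j$. The Mycielskian $M(D)$ of a digraph $D$ has vertex set $V(D)\times\{0,1\}\cup\{z\}$ ($z$ a new vertex) and edge set $\{((v,0),(w,i)):(v,w)\in E(D),\ i\in\{0,1\}\}\cup\{((v,1),(w,0)):(v,w)\in E(D)\}\cup\{(z,(v,1)):v\in V(D)\}$; $M(T_n)\setminus\{z\}$ denotes deletion of $z$. For a digraph $H$, $H^t$ is its $t$-fold OR-power: vertex set $V(H)^t$, with a directed edge from $(a_1,\dots,a_t)$ to $(b_1,\dots,b_t)$ iff $(a_j,b_j)\in E(H)$ for some $j$. A transitive clique of size $m$ is a set of distinct vertices $q_1,\dots,q_m$ with $(q_i,q_j)$ an edge for all $i<j$. -}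

module Defs where

open import Data.Nat using (ℕ; _^_)
open import Data.Fin using (Fin; _<_)
open import Data.Bool using (Bool; true; false)
open import Data.Product using (_×_; _,_; ∃-syntax)
open import Data.Sum using (_⊎_)
open import Data.Vec using (Vec; lookup)
open import Relation.Binary.PropositionalEquality using (_≡_)
open import Level using (0ℓ; suc)
open import Function.Definitions using (Injective)

record Digraph : Set₁ where
  field
    V : Set
    E : V → V → Set
open Digraph public

T : ℕ → Digraph
T n = record { V = Fin n ; E = λ i j → i < j }

-- Mycielskian of D with the vertex z deleted.
-- Vertex (v , false) stands for (v,0), (v , true) for (v,1).
data MEdge (D : Digraph) : V D × Bool → V D × Bool → Set where
  e00 : ∀ {v w} → E D v w → MEdge D (v , false) (w , false)
  e01 : ∀ {v w} → E D v w → MEdge D (v , false) (w , true)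
  e10 : ∀ {v w} → E D v w → MEdge D (v , true) (w , false)

Mz : Digraph → Digraph
Mz D = record { V = V D × Bool ; E = MEdge D }

ORPow : Digraph → ℕ → Digraph
ORPow H t = record
  { V = Vec (V H) t
  ; E = λ a b → ∃[ j ] E H (lookup a j) (lookup b j) }

IsTransitiveClique : (D : Digraph) (m : ℕ) → (Fin m → V D) → Set
IsTransitiveClique D m q =
  Injective _≡_ _≡_ q × (∀ (i j : Fin m) → i < j → E D (q i) (q j))

-- Give each tuple a ∈ [n]ⁿ the marked coordinate ℓ(a) ≡ Σ a (mod n) and send it to the vertex
-- whose j-th entry is (a_j , [j = ℓ(a)]).  Sort the nⁿ tuples by weight Σ a, breaking ties
-- lexicographically by the unmarked entries.  If a precedes b, some coordinate j has a_j < b_j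
-- and is unmarked in a or in b, which is an edge in coordinate j.  When Σ a < Σ b but
-- ℓ(a) = ℓ(b), the weights differ by at least n, more than the marked entry b_ℓ < n can supply,
-- so the unmarked entries of b outweigh those of a; when Σ a = Σ b, the first difference of the
-- unmarked entries is such a coordinate.

module Submission where

open import Defs
open import Data.Nat using (ℕ; _≤_; _^_)
open import Data.Fin using (Fin)
open import Data.Bool using (true)
open import Data.Product using (_×_; Σ-syntax; ∃-syntax; proj₂)
open import Data.Vec using (lookup)
open import Relation.Binary.PropositionalEquality using (_≡_)

open import Data.Bool using (Bool; false)
open import Data.Fin as Fin using (toℕ; punchIn; punchOut; finToFun; funToFin)
import Data.Fin.Properties as Finₚ
open import Data.List as List using (List; allFin)
open import Data.List.Membership.Propositional.Properties using (∈-lookup)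
open import Data.List.Properties using (length-tabulate)
open import Data.List.Relation.Binary.Permutation.Propositional using (↭⇒↭ₛ; ↭-sym)
open import Data.List.Relation.Binary.Permutation.Propositional.Properties using (↭-length)
import Data.List.Relation.Binary.Permutation.Setoid.Properties as Permutationₛ
import Data.List.Relation.Unary.All as All
open import Data.List.Relation.Unary.AllPairs using (AllPairs; _∷_)
import Data.List.Relation.Unary.Sorted.TotalOrder.Properties as Sorted
open import Data.List.Relation.Unary.Unique.Propositional.Properties using (allFin⁺)
open import Data.Nat using (zero; suc; _+_; _*_; _<_; s≤s; NonZero; _%_; _/_; _<?_)
open import Data.Nat.DivMod using (_mod_; m≡m%n+[m/n]*n; m%n<n)
open import Data.Nat.Properties
open import Algebra.Properties.CommutativeMonoid.Sum +-0-commutativeMonoid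
  using (sum; sum-remove; sum-cong-≗)
open import Data.Product using (_,_; proj₁)
open import Data.Sum using (_⊎_; inj₁; inj₂; map)
open import Data.Vec using (Vec; _∷_; tabulate)
open import Data.Vec.Functional using (removeAt)
open import Data.Vec.Properties using (lookup∘tabulate)
open import Data.Vec.Relation.Binary.Lex.Core using (this; next)
open import Data.Vec.Relation.Binary.Lex.NonStrict using (Lex-≤)
import Data.Vec.Relation.Binary.Lex.NonStrict as Lex
open import Function using (_∘_)
open import Relation.Binary.Bundles using (DecTotalOrder)
import Relation.Binary.Construct.On as On
open import Relation.Binary.Definitions using (Irreflexive; tri<; tri≈; tri>)
open import Relation.Binary.PropositionalEquality
  using (refl; sym; trans; cong; cong₂; subst; subst₂; _≢_; _≗_; setoid; module ≡-Reasoning)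
open import Relation.Nullary using (¬_; yes; no; does; contradiction)
open import Relation.Nullary.Decidable using (dec-true; dec-false)

sum-<⇒∃< : ∀ {k} (f g : Fin k → ℕ) → sum f < sum g → ∃[ j ] f j < g j
sum-<⇒∃< {zero}  f g ()
sum-<⇒∃< {suc k} f g Σf<Σg with sum (f ∘ Fin.suc) <? sum (g ∘ Fin.suc)
... | yes tail< = let j , fj<gj = sum-<⇒∃< _ _ tail< in Fin.suc j , fj<gj
... | no  tail≮ = Fin.zero ,
  +-cancelʳ-< _ _ _ (<-≤-trans Σf<Σg (+-monoʳ-≤ (g Fin.zero) (≮⇒≥ tail≮)))

sum-removeAt-< : ∀ {k d} (f g : Fin (suc k) → ℕ) (l : Fin (suc k)) →
                 g l < d → sum f + d ≤ sum g → sum (removeAt f l) < sum (removeAt g l)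
sum-removeAt-< {d = d} f g l gl<d Σf+d≤Σg = +-cancelʳ-< d _ _ (begin-strict
  sum (removeAt f l) + d        ≤⟨ +-monoˡ-≤ d (m≤n+m _ (f l)) ⟩
  f l + sum (removeAt f l) + d  ≡⟨ cong (_+ d) (sum-remove f) ⟨
  sum f + d                     ≤⟨ Σf+d≤Σg ⟩
  sum g                         ≡⟨ sum-remove g ⟩
  g l + sum (removeAt g l)      <⟨ +-monoˡ-< _ gl<d ⟩
  d + sum (removeAt g l)        ≡⟨ +-comm d _ ⟩
  sum (removeAt g l) + d        ∎)
  where open ≤-Reasoning

sum-removeAt-≗⇒≗ : ∀ {k} (f g : Fin (suc k) → ℕ) (l : Fin (suc k)) →
                   sum f ≡ sum g → removeAt f l ≗ removeAt g l → f ≗ g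
sum-removeAt-≗⇒≗ f g l Σf≡Σg rest j with l Finₚ.≟ j
... | yes refl = +-cancelʳ-≡ (sum (removeAt f l)) (f l) (g l) (begin
  f l + sum (removeAt f l)  ≡⟨ sum-remove f ⟨
  sum f                     ≡⟨ Σf≡Σg ⟩
  sum g                     ≡⟨ sum-remove g ⟩
  g l + sum (removeAt g l)  ≡⟨ cong (g l +_) (sum-cong-≗ rest) ⟨
  g l + sum (removeAt f l)  ∎)
  where open ≡-Reasoning
... | no l≢j = subst (λ i → f i ≡ g i) (Finₚ.punchIn-punchOut l≢j) (rest (punchOut l≢j))

m%n≡o%n∧m<o⇒m+n≤o : ∀ {m o} n .{{_ : NonZero n}} → m % n ≡ o % n → m < o → m + n ≤ o
m%n≡o%n∧m<o⇒m+n≤o {m} {o} n m%n≡o%n m<o = begin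
  m + n                  ≡⟨ cong (_+ n) (m≡m%n+[m/n]*n m n) ⟩
  m % n + m / n * n + n  ≡⟨ +-assoc (m % n) _ n ⟩
  m % n + (m / n * n + n) ≡⟨ cong₂ _+_ m%n≡o%n (+-comm (m / n * n) n) ⟩
  o % n + suc (m / n) * n ≤⟨ +-monoʳ-≤ (o % n) (*-monoˡ-≤ n m/n<o/n) ⟩
  o % n + o / n * n       ≡⟨ m≡m%n+[m/n]*n o n ⟨
  o                       ∎
  where
  open ≤-Reasoning
  m/n<o/n : m / n < o / n
  m/n<o/n = ≰⇒> λ o/n≤m/n → <⇒≱ m<o (begin
    o                  ≡⟨ m≡m%n+[m/n]*n o n ⟩
    o % n + o / n * n  ≤⟨ +-monoʳ-≤ (o % n) (*-monoˡ-≤ n o/n≤m/n) ⟩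
    o % n + m / n * n  ≡⟨ cong (_+ m / n * n) m%n≡o%n ⟨
    m % n + m / n * n  ≡⟨ m≡m%n+[m/n]*n m n ⟨
    m                  ∎)

mod≡⇒%≡ : ∀ {m o} n .{{_ : NonZero n}} → m mod n ≡ o mod n → m % n ≡ o % n
mod≡⇒%≡ {m} {o} n eq = begin
  m % n            ≡⟨ Finₚ.toℕ-fromℕ< (m%n<n m n) ⟨
  toℕ (m mod n)    ≡⟨ cong toℕ eq ⟩
  toℕ (o mod n)    ≡⟨ Finₚ.toℕ-fromℕ< (m%n<n o n) ⟩
  o % n            ∎
  where open ≡-Reasoning

Lex-≤-tabulate⇒≗⊎∃< : ∀ {k} (f g : Fin k → ℕ) →
                      Lex-≤ _≡_ _≤_ (tabulate f) (tabulate g) → f ≗ g ⊎ ∃[ j ] f j < g j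
Lex-≤-tabulate⇒≗⊎∃< {zero}  f g _ = inj₁ λ ()
Lex-≤-tabulate⇒≗⊎∃< {suc k} f g (this (f₀≤g₀ , f₀≢g₀) _) = inj₂ (Fin.zero , ≤∧≢⇒< f₀≤g₀ f₀≢g₀)
Lex-≤-tabulate⇒≗⊎∃< {suc k} f g (next f₀≡g₀ rest)
  with Lex-≤-tabulate⇒≗⊎∃< (f ∘ Fin.suc) (g ∘ Fin.suc) rest
... | inj₁ tail≗        = inj₁ λ { Fin.zero → f₀≡g₀ ; (Fin.suc j) → tail≗ j }
... | inj₂ (j , fj<gj)  = inj₂ (Fin.suc j , fj<gj)

≢⇒≢ˡ⊎≢ʳ : ∀ {k} {x y : Fin k} → x ≢ y → ∀ z → z ≢ x ⊎ z ≢ y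
≢⇒≢ˡ⊎≢ʳ {x = x} x≢y z with z Finₚ.≟ x
... | yes refl = inj₂ x≢y
... | no  z≢x  = inj₁ z≢x

finToFun-injective : ∀ {m n} {i j : Fin (m ^ n)} → finToFun {m} {n} i ≗ finToFun j → i ≡ j
finToFun-injective {m} {n} {i} {j} eq =
  trans (sym (Finₚ.funToFin-finToFin {n} {m} i))
        (trans (funToFin-cong eq) (Finₚ.funToFin-finToFin {n} {m} j))
  where
  funToFin-cong : ∀ {k} {f g : Fin k → Fin m} → f ≗ g → funToFin f ≡ funToFin g
  funToFin-cong {zero}  _   = refl
  funToFin-cong {suc k} f≗g = cong₂ Fin.combine (f≗g Fin.zero) (funToFin-cong (f≗g ∘ Fin.suc))

AllPairs-lookup : ∀ {a r} {A : Set a} {R : A → A → Set r} {xs} → AllPairs R xs →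
                  ∀ {i j} → i Fin.< j → R (List.lookup xs i) (List.lookup xs j)
AllPairs-lookup (Rx ∷ _)     {Fin.zero}  {Fin.suc j} _         = All.lookup Rx (∈-lookup j)
AllPairs-lookup (_  ∷ pairs) {Fin.suc i} {Fin.suc j} (s≤s i<j) = AllPairs-lookup pairs i<j

module _ {a ℓ₁ ℓ₂} (O : DecTotalOrder a ℓ₁ ℓ₂) {k} (key : Fin k → DecTotalOrder.Carrier O) where

  private
    open import Data.List.Sort (On.decTotalOrder O key) using (sort; sort-↭; sort-↗)

    sorted : List (Fin k)
    sorted = sort (allFin k)

    k≡length : k ≡ List.length sorted
    k≡length = sym (trans (↭-length (sort-↭ (allFin k))) (length-tabulate (λ i → i)))

  sortedEnumeration : Σ[ σ ∈ (Fin k → Fin k) ]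
    (∀ {i j} → i Fin.< j → σ i ≢ σ j × DecTotalOrder._≤_ O (key (σ i)) (key (σ j)))
  sortedEnumeration = σ , λ i<j → AllPairs-lookup unique (cast-< i<j) ,
    Sorted.lookup-mono-≤ (DecTotalOrder.totalOrder (On.decTotalOrder O key))
      (sort-↗ (allFin k)) (<⇒≤ (cast-< i<j))
    where
    σ : Fin k → Fin k
    σ i = List.lookup sorted (Fin.cast k≡length i)

    cast-< : ∀ {i j} → i Fin.< j → Fin.cast k≡length i Fin.< Fin.cast k≡length j
    cast-< {i} {j} = subst₂ _<_ (sym (Finₚ.toℕ-cast k≡length i)) (sym (Finₚ.toℕ-cast k≡length j))

    unique : AllPairs _≢_ sorted
    unique = Permutationₛ.Unique-resp-↭ (setoid (Fin k))
               (↭⇒↭ₛ (↭-sym (sort-↭ (allFin k)))) (allFin⁺ k)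

irreflexive⇒transitiveClique : ∀ {D : Digraph} {k} {q : Fin k → V D} → Irreflexive _≡_ (E D) →
  (∀ i j → i Fin.< j → E D (q i) (q j)) → IsTransitiveClique D k q
irreflexive⇒transitiveClique {q = q} irr edge = injective , edge
  where
  injective : ∀ {i j} → q i ≡ q j → i ≡ j
  injective {i} {j} qi≡qj with Finₚ.<-cmp i j
  ... | tri< i<j _ _ = contradiction (edge i j i<j) (irr qi≡qj)
  ... | tri≈ _ i≡j _ = i≡j
  ... | tri> _ _ j<i = contradiction (edge j i j<i) (irr (sym qi≡qj))

Mz-irreflexive : ∀ {D : Digraph} → Irreflexive _≡_ (E D) → Irreflexive _≡_ (E (Mz D))
Mz-irreflexive irr refl (e00 vv) = irr refl vv

ORPow-irreflexive : ∀ {H : Digraph} {t} → Irreflexive _≡_ (E H) → Irreflexive _≡_ (E (ORPow H t))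
ORPow-irreflexive irr refl (_ , e) = irr refl e

MEdge⁺ : ∀ {D : Digraph} {v w x y} → E D v w → x ≡ false ⊎ y ≡ false → MEdge D (v , x) (w , y)
MEdge⁺ {x = false} {false} vw _ = e00 vw
MEdge⁺ {x = false} {true}  vw _ = e01 vw
MEdge⁺ {x = true}  {false} vw _ = e10 vw
MEdge⁺ {x = true}  {true}  vw (inj₁ ())
MEdge⁺ {x = true}  {true}  vw (inj₂ ())

module MarkedTuples (m : ℕ) where

  private
    n : ℕ
    n = suc m

  Tuple : Set
  Tuple = Fin n → Fin n

  values : Tuple → Fin n → ℕ
  values a = toℕ ∘ a

  weight : Tuple → ℕ
  weight a = sum (values a)

  marked : Tuple → Fin n
  marked a = weight a mod n

  coordinate : Tuple → Fin n → Fin n × Bool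
  coordinate a j = a j , does (j Finₚ.≟ marked a)

  vertex : Tuple → V (ORPow (Mz (T n)) n)
  vertex a = tabulate (coordinate a)

  sortKey : Tuple → Vec ℕ n
  sortKey a = weight a ∷ tabulate (removeAt (values a) (marked a))

  _≼_ : Tuple → Tuple → Set
  a ≼ b = Lex-≤ _≡_ _≤_ (sortKey a) (sortKey b)

  Ascent : Tuple → Tuple → Set
  Ascent a b = ∃[ j ] a j Fin.< b j × (j ≢ marked a ⊎ j ≢ marked b)

  ascent⇒edge : ∀ {a b} → Ascent a b → E (ORPow (Mz (T n)) n) (vertex a) (vertex b)
  ascent⇒edge {a} {b} (j , aj<bj , unmarked) = j ,
    subst₂ (MEdge (T n)) (sym (lookup∘tabulate (coordinate a) j))
                         (sym (lookup∘tabulate (coordinate b) j))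
      (MEdge⁺ aj<bj (map (dec-false (j Finₚ.≟ marked a)) (dec-false (j Finₚ.≟ marked b)) unmarked))

  vertex-marked : ∀ a → proj₂ (lookup (vertex a) (marked a)) ≡ true
  vertex-marked a = trans (cong proj₂ (lookup∘tabulate (coordinate a) (marked a)))
                           (dec-true (marked a Finₚ.≟ marked a) refl)

  removeAt-ascent : ∀ {a b} →
    ∃[ j ] removeAt (values a) (marked a) j < removeAt (values b) (marked a) j → Ascent a b
  removeAt-ascent {a} (j , lt) = punchIn (marked a) j , lt , inj₁ (Finₚ.punchInᵢ≢i (marked a) j)

  weight-<⇒ascent : ∀ {a b} → weight a < weight b → Ascent a b
  weight-<⇒ascent {a} {b} Σa<Σb with marked a Finₚ.≟ marked b
  ... | no  la≢lb = let j , aj<bj = sum-<⇒∃< (values a) (values b) Σa<Σb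
                    in  j , aj<bj , ≢⇒≢ˡ⊎≢ʳ la≢lb j
  ... | yes la≡lb = removeAt-ascent (sum-<⇒∃< _ _
        (sum-removeAt-< (values a) (values b) (marked a) (Finₚ.toℕ<n (b (marked a))) gap))
    where
    gap : weight a + n ≤ weight b
    gap = m%n≡o%n∧m<o⇒m+n≤o n (mod≡⇒%≡ {weight a} {weight b} n la≡lb) Σa<Σb

  weight-≡⇒ascent : ∀ {a b} → weight a ≡ weight b →
    Lex-≤ _≡_ _≤_ (tabulate (removeAt (values a) (marked a)))
                  (tabulate (removeAt (values b) (marked a))) →
    ¬ a ≗ b → Ascent a b
  weight-≡⇒ascent {a} {b} Σa≡Σb rest a≉b with Lex-≤-tabulate⇒≗⊎∃< _ _ rest
  ... | inj₁ rest≗ = contradiction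
        (Finₚ.toℕ-injective ∘ sum-removeAt-≗⇒≗ (values a) (values b) (marked a) Σa≡Σb rest≗) a≉b
  ... | inj₂ ascent = removeAt-ascent ascent

  ≼⇒ascent : ∀ {a b} → a ≼ b → ¬ a ≗ b → Ascent a b
  ≼⇒ascent (this (Σa≤Σb , Σa≢Σb) _) _ = weight-<⇒ascent (≤∧≢⇒< Σa≤Σb Σa≢Σb)
  ≼⇒ascent {a} {b} (next Σa≡Σb rest) = weight-≡⇒ascent Σa≡Σb
    (subst (λ l → Lex-≤ _≡_ _≤_ _ (tabulate (removeAt (values b) l))) (cong (_mod n) (sym Σa≡Σb)) rest)

lemma5 : (n : ℕ) → 1 ≤ n →
    Σ[ q ∈ (Fin (n ^ n) → V (ORPow (Mz (T n)) n)) ]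
      (IsTransitiveClique (ORPow (Mz (T n)) n) (n ^ n) q
       × (∀ (i : Fin (n ^ n)) → ∃[ j ] proj₂ (lookup (q i) j) ≡ true))
lemma5 (suc m) _ =
  q , irreflexive⇒transitiveClique (ORPow-irreflexive (Mz-irreflexive Finₚ.<-irrefl)) edge
    , λ i → marked (finToFun (σ i)) , vertex-marked (finToFun (σ i))
  where
  open MarkedTuples m

  enumeration : Σ[ σ ∈ (Fin (suc m ^ suc m) → Fin (suc m ^ suc m)) ]
    (∀ {i j} → i Fin.< j → σ i ≢ σ j × finToFun (σ i) ≼ finToFun (σ j))
  enumeration = sortedEnumeration (Lex.≤-decTotalOrder ≤-decTotalOrder (suc m)) (sortKey ∘ finToFun)

  σ : Fin (suc m ^ suc m) → Fin (suc m ^ suc m)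
  σ = proj₁ enumeration

  q : Fin (suc m ^ suc m) → V (ORPow (Mz (T (suc m))) (suc m))
  q = vertex ∘ finToFun ∘ σ

  edge : ∀ i j → i Fin.< j → E (ORPow (Mz (T (suc m))) (suc m)) (q i) (q j)
  edge i j i<j = let σi≢σj , σi≼σj = proj₂ enumeration i<j in
    ascent⇒edge (≼⇒ascent σi≼σj (σi≢σj ∘ finToFun-injective))
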